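{- Let $m\ge 3$ and $N\ge 1$ be integers, and let $C=A_-A_+-A_+A_-$ be the commutator of the inner and outer adjacency operators on the graph $\mathcal{C}_m^N$. If $v,w$ are vertices of $\mathcal{C}_m^N$ whose level vectors differ (i.e. $d_k(v)\neq d_k(w)$ for some $k$), then $(C\mathbf{1}_w)(v)=0$, where $\mathbf{1}_w$ is the indicator function of the vertex $w$. In other words, the matrix of $C$ is supported on pairs of vertices with equal level vectors.
   Context: Vertices of $\mathcal{C}_m^N$ are the elements of $\mathbb{Z}_m^N$, written $v=(\ell_1,\dots,\ell_N)$ with $\ell_i\in\{ -\lfloor (m-1)/2\rfloor,\dots,\lfloor m/2\rfloor\}$ (representatives modulo $m$). Let $e_k$ be the element with $1$ in coordinate $k$ and $0$ elsewhere; $\mathcal{C}_m^N$ is the Cayley graph with generators $\{\pm e_k\}_{k=1}^N$, so $v\sim w$ iff $v-w=\pm e_k$ (mod $m$) for some $k$. The $k$th level of $v$ is $d_k(v)=|\ell_k|$, the level vector of $v$ is $(d_1(v),\dots,d_N(v))$, and $d(v)=\sum_k d_k(v)$ (the path distance from $v$ to $0$). Vertex functions are maps $f:\mathbb{Z}_m^N\to\mathbb{C}$. The outer adjacency operator is $(A_+f)(v)=\sum_{w\sim v,\ d(w)=d(v)-1} f(w)$ (so it maps functions supported at distance $r$ to functions supported at distance $r+1$), and the inner adjacency operator $A_-$ is its adjoint: $(A_-f)(v)=\sum_{w\sim v,\ d(w)=d(v)+1} f(w)$. -}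

module Defs where

open import Data.Nat using (ℕ; zero; suc; _+_; _∸_; _⊓_; NonZero)
open import Data.Nat.DivMod using (_mod_)
open import Data.Fin using (Fin; toℕ)
open import Data.Fin.Properties using () renaming (_≟_ to _≟ᶠ_)
open import Data.Vec using (Vec; []; _∷_; lookup; updateAt)
open import Data.Vec.Properties using (≡-dec)
open import Data.List using (List; []; _∷_; map; concatMap; allFin; foldr)
open import Data.Bool.ListAction using (any)
open import Data.Bool using (Bool; true; false; _∨_; _∧_; if_then_else_)
open import Data.Integer using (ℤ; _-_) renaming (_+_ to _+ℤ_; 0ℤ to 0ℤ; 1ℤ to 1ℤ)
open import Relation.Nullary.Decidable using (⌊_⌋)
import Data.Nat as ℕ

module _ (m : ℕ) .{{_ : NonZero m}} where

  Vertex : ℕ → Set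
  Vertex N = Vec (Fin m) N

  allVertices : (N : ℕ) → List (Vertex N)
  allVertices zero = [] ∷ []
  allVertices (suc N) = concatMap (λ x → map (x ∷_) (allVertices N)) (allFin m)

  inc dec : Fin m → Fin m
  inc x = (toℕ x + 1) mod m
  dec x = (toℕ x + (m ∸ 1)) mod m

  plusE minusE : ∀ {N} → Vertex N → Fin N → Vertex N
  plusE  v k = updateAt v k inc
  minusE v k = updateAt v k dec

  _≟ᵛ_ : ∀ {N} (v w : Vertex N) → _
  _≟ᵛ_ = ≡-dec _≟ᶠ_

  adjacent : ∀ {N} → Vertex N → Vertex N → Bool
  adjacent {N} v w =
    any (λ k → ⌊ w ≟ᵛ plusE v k ⌋ ∨ ⌊ w ≟ᵛ minusE v k ⌋) (allFin N)

  -- level of a coordinate: |ℓ| for the representative ℓ in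
  -- {-⌊(m-1)/2⌋,…,⌊m/2⌋}, i.e. min(a, m - a) for a ∈ {0,…,m-1}
  level : Fin m → ℕ
  level x = toℕ x ⊓ (m ∸ toℕ x)

  levelAt : ∀ {N} → Vertex N → Fin N → ℕ
  levelAt v k = level (lookup v k)

  dist : ∀ {N} → Vertex N → ℕ
  dist [] = 0
  dist (x ∷ v) = level x + dist v

  sumℤ : List ℤ → ℤ
  sumℤ = foldr _+ℤ_ 0ℤ

  VFun : ℕ → Set
  VFun N = Vertex N → ℤ

  A₊ : ∀ {N} → VFun N → VFun N
  A₊ {N} f v = sumℤ (map (λ w →
      if adjacent v w ∧ ⌊ dist w + 1 ℕ.≟ dist v ⌋ then f w else 0ℤ)
    (allVertices N))

  A₋ : ∀ {N} → VFun N → VFun N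
  A₋ {N} f v = sumℤ (map (λ w →
      if adjacent v w ∧ ⌊ dist w ℕ.≟ dist v + 1 ⌋ then f w else 0ℤ)
    (allVertices N))

  Comm : ∀ {N} → VFun N → VFun N
  Comm f v = A₋ (A₊ f) v - A₊ (A₋ f) v

  indicator : ∀ {N} → Vertex N → VFun N
  indicator w u = if ⌊ u ≟ᵛ w ⌋ then 1ℤ else 0ℤ

-- Entry (v, w) of A₋A₊ − A₊A₋ counts the paths v → x → w that step outwards and then
-- inwards, minus those that step inwards and then outwards; either kind forces d(v) = d(w).
-- Let σ swap, in every coordinate c, the values v_c and w_c. For a middle vertex x of
-- such a path the two steps change different coordinates (one coordinate alone would,
-- with d(v) = d(w), make the level vectors of v and w equal), so σ x is the opposite
-- corner of the rectangle through v, x, w and d(σ x) + d(x) = d(v) + d(w). Hence the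
-- involution σ exchanges the two kinds of middle vertices and the counts agree.
module Submission where

open import Defs
open import Data.Nat as ℕ using (ℕ; zero; suc; NonZero; _+_; _≤_)
import Data.Nat.Properties as ℕ
open import Algebra.Properties.CommutativeSemigroup ℕ.+-commutativeSemigroup
  using (x∙yz≈xz∙y; xy∙z≈xz∙y; xy∙z≈zy∙x) renaming (interchange to +-interchange)
open import Data.Integer using (ℤ; 0ℤ; 1ℤ; _-_) renaming (_+_ to _+ℤ_)
import Data.Integer.Properties as ℤ
open import Algebra.Properties.CommutativeSemigroup ℤ.+-commutativeSemigroup
  using () renaming (interchange to +ℤ-interchange)
open import Data.Fin using (Fin; zero; suc; _≟_)
import Data.Fin.Properties as Fin
open import Data.Fin.Permutation.Components using (transpose)
open import Data.List using (List; []; _∷_; map; concatMap; allFin; foldr; _++_)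
open import Data.List.Properties using (map-cong; map-∘; map-tabulate)
open import Data.List.Membership.Propositional using (lose)
open import Data.List.Membership.Propositional.Properties using (∈-allFin)
open import Data.List.Relation.Unary.Any using (satisfied)
open import Data.List.Relation.Unary.Any.Properties using (any⁺; any⁻)
open import Data.Vec using (Vec; []; _∷_; head; tail; lookup; updateAt; tabulate)
open import Data.Vec.Properties
  using ( lookup∘updateAt; lookup∘updateAt′; updateAt-updateAt; updateAt-commutes
        ; lookup∘tabulate; tabulate-cong; tabulate∘lookup)
open import Data.Bool using (Bool; true; false; T; _∧_; _∨_; if_then_else_)
open import Data.Bool.Properties using (T-∧; T-∨; if-∧; if-eta; if-cong-then)
open import Data.Product using (∃; ∃₂; _×_; _,_)
open import Data.Product.Function.NonDependent.Propositional using (_×-⇔_)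
open import Data.Sum using (_⊎_; inj₁; inj₂)
open import Function using (id; _∘_; _⇔_; mk⇔; Equivalence)
import Function.Properties.Equivalence as ⇔
open import Relation.Binary.Definitions using (DecidableEquality)
open import Relation.Binary.PropositionalEquality
open import Relation.Nullary using (Dec; yes; no; ¬_; contradiction)
open import Relation.Nullary.Decidable using (⌊_⌋; toWitness; fromWitness; dec-true; dec-false)

∑ : {A : Set} → List A → (A → ℤ) → ℤ
∑ xs f = foldr _+ℤ_ 0ℤ (map f xs)

syntax ∑ xs (λ x → e) = ∑[ x ∈ xs ] e

∑-cong : ∀ {A : Set} xs {f g : A → ℤ} → (∀ x → f x ≡ g x) → ∑ xs f ≡ ∑ xs g
∑-cong xs f≗g = cong (foldr _+ℤ_ 0ℤ) (map-cong f≗g xs)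

∑-zero : ∀ {A : Set} xs {f : A → ℤ} → (∀ x → f x ≡ 0ℤ) → ∑ xs f ≡ 0ℤ
∑-zero []       f≗0 = refl
∑-zero (x ∷ xs) f≗0 rewrite f≗0 x | ∑-zero xs f≗0 = refl

∑-++ : ∀ {A : Set} xs ys (f : A → ℤ) → ∑ (xs ++ ys) f ≡ ∑ xs f +ℤ ∑ ys f
∑-++ []       ys f = sym (ℤ.+-identityˡ _)
∑-++ (x ∷ xs) ys f rewrite ∑-++ xs ys f = sym (ℤ.+-assoc (f x) _ _)

∑-distrib-+ : ∀ {A : Set} xs (f g : A → ℤ) → ∑[ x ∈ xs ] (f x +ℤ g x) ≡ ∑ xs f +ℤ ∑ xs g
∑-distrib-+ []       f g = refl
∑-distrib-+ (x ∷ xs) f g rewrite ∑-distrib-+ xs f g = +ℤ-interchange (f x) (g x) _ _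

∑-comm : ∀ {A B : Set} xs ys (h : A → B → ℤ) →
  ∑[ x ∈ xs ] ∑[ y ∈ ys ] h x y ≡ ∑[ y ∈ ys ] ∑[ x ∈ xs ] h x y
∑-comm []       ys h = sym (∑-zero ys (λ _ → refl))
∑-comm (x ∷ xs) ys h rewrite ∑-comm xs ys h =
  sym (∑-distrib-+ ys (h x) (λ y → ∑[ x ∈ xs ] h x y))

∑-concatMap : ∀ {A B : Set} (g : A → List B) xs (f : B → ℤ) →
  ∑ (concatMap g xs) f ≡ ∑[ x ∈ xs ] ∑ (g x) f
∑-concatMap g []       f = refl
∑-concatMap g (x ∷ xs) f rewrite ∑-++ (g x) (concatMap g xs) f | ∑-concatMap g xs f = refl

-- A list enumerates its element type exactly once, phrased by its effect on sums.
Enumerates : {A : Set} → List A → Set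
Enumerates {A} xs = ∀ (f : A → ℤ) y → (∀ x → x ≢ y → f x ≡ 0ℤ) → ∑ xs f ≡ f y

∑-allFin-suc : ∀ n (f : Fin (suc n) → ℤ) → ∑ (allFin (suc n)) f ≡ f zero +ℤ ∑[ i ∈ allFin n ] f (suc i)
∑-allFin-suc n f = cong (λ xs → f zero +ℤ foldr _+ℤ_ 0ℤ xs)
  (trans (map-tabulate suc f) (sym (map-tabulate id (f ∘ suc))))

allFin-enumerates : ∀ n → Enumerates (allFin n)
allFin-enumerates (suc n) f zero f≗0 rewrite ∑-allFin-suc n f
  | ∑-zero (allFin n) (λ i → f≗0 (suc i) λ ()) = ℤ.+-identityʳ (f zero)
allFin-enumerates (suc n) f (suc j) f≗0 rewrite ∑-allFin-suc n f | f≗0 zero (λ ()) =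
  trans (ℤ.+-identityˡ _) (allFin-enumerates n (f ∘ suc) j λ i i≢j → f≗0 (suc i) (i≢j ∘ Fin.suc-injective))

[]-enumerates : ∀ {A : Set} → Enumerates {Vec A 0} ([] ∷ [])
[]-enumerates f [] _ = ℤ.+-identityʳ (f [])

∷-enumerates : ∀ {A : Set} {n} {xs : List A} {ys : List (Vec A n)} →
  Enumerates xs → Enumerates ys → Enumerates (concatMap (λ x → map (x ∷_) ys) xs)
∷-enumerates {xs = xs} {ys} xs-enum ys-enum f (x ∷ y) f≗0 = begin
  ∑ (concatMap (λ x → map (x ∷_) ys) xs) f
    ≡⟨ ∑-concatMap _ xs f ⟩
  ∑[ x′ ∈ xs ] ∑ (map (x′ ∷_) ys) f
    ≡⟨ ∑-cong xs (λ x′ → cong (foldr _+ℤ_ 0ℤ) (sym (map-∘ ys))) ⟩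
  ∑[ x′ ∈ xs ] ∑[ y′ ∈ ys ] f (x′ ∷ y′)
    ≡⟨ xs-enum _ x (λ x′ x′≢x → ∑-zero ys λ y′ → f≗0 _ (x′≢x ∘ cong head)) ⟩
  ∑[ y′ ∈ ys ] f (x ∷ y′)
    ≡⟨ ys-enum _ y (λ y′ y′≢y → f≗0 _ (y′≢y ∘ cong tail)) ⟩
  f (x ∷ y)
    ∎
  where open ≡-Reasoning

allVertices-enumerates : ∀ m .{{_ : NonZero m}} N → Enumerates (allVertices m N)
allVertices-enumerates m zero    = []-enumerates
allVertices-enumerates m (suc N) = ∷-enumerates {xs = allFin m} (allFin-enumerates m) (allVertices-enumerates m N)

𝟙 : Bool → ℤ
𝟙 b = if b then 1ℤ else 0ℤ

module _ {P : Set} {a b : ℤ} where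

  if-yes : (p? : Dec P) → P → (if ⌊ p? ⌋ then a else b) ≡ a
  if-yes (yes _) _ = refl
  if-yes (no ¬p) p = contradiction p ¬p

  if-no : (p? : Dec P) → ¬ P → (if ⌊ p? ⌋ then a else b) ≡ b
  if-no (yes p) ¬p = contradiction p ¬p
  if-no (no _)  _  = refl

module _ {A : Set} (_≟_ : DecidableEquality A) (xs : List A) (xs-enum : Enumerates xs) where

  ∑-reindex : (σ : A → A) → (∀ x → σ (σ x) ≡ x) → (f : A → ℤ) → ∑[ x ∈ xs ] f (σ x) ≡ ∑ xs f
  ∑-reindex σ σ-involutive f = begin
    ∑[ u ∈ xs ] f (σ u)
      ≡⟨ ∑-cong xs (λ u → sym (trans (xs-enum _ (σ u) (kernel-off u)) (if-yes (σ u ≟ σ u) refl))) ⟩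
    ∑[ u ∈ xs ] ∑[ x ∈ xs ] kernel u x
      ≡⟨ ∑-comm xs xs kernel ⟩
    ∑[ x ∈ xs ] ∑[ u ∈ xs ] kernel u x
      ≡⟨ ∑-cong xs (λ x → xs-enum _ (σ x) (kernel-off′ x)) ⟩
    ∑[ x ∈ xs ] kernel (σ x) x
      ≡⟨ ∑-cong xs (λ x → if-yes (x ≟ σ (σ x)) (sym (σ-involutive x))) ⟩
    ∑ xs f
      ∎
    where
    open ≡-Reasoning
    kernel : A → A → ℤ
    kernel u x = if ⌊ x ≟ σ u ⌋ then f x else 0ℤ
    kernel-off : ∀ u x → x ≢ σ u → kernel u x ≡ 0ℤ
    kernel-off u x = if-no (x ≟ σ u)
    kernel-off′ : ∀ x u → u ≢ σ x → kernel u x ≡ 0ℤ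
    kernel-off′ x u u≢σx = kernel-off u x λ x≡σu → u≢σx (trans (sym (σ-involutive u)) (cong σ (sym x≡σu)))

  ∑-if-indicator : (b : A → Bool) (w : A) → ∑[ u ∈ xs ] (if b u then 𝟙 ⌊ u ≟ w ⌋ else 0ℤ) ≡ 𝟙 (b w)
  ∑-if-indicator b w =
    trans (xs-enum _ w λ u u≢w → trans (if-cong-then (b u) (if-no (u ≟ w) u≢w)) (if-eta (b u)))
          (if-cong-then (b w) (if-yes (w ≟ w) refl))

module _ {n} (i j : Fin n) where

  transpose-matchˡ : transpose i j i ≡ j
  transpose-matchˡ rewrite dec-true (i ≟ i) refl = refl

  transpose-matchʳ : transpose i j j ≡ i
  transpose-matchʳ with j ≟ i
  ... | yes j≡i = j≡i
  ... | no  j≢i rewrite dec-true (j ≟ j) refl = refl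

  transpose-other : ∀ {k} → k ≢ i → k ≢ j → transpose i j k ≡ k
  transpose-other {k} k≢i k≢j rewrite dec-false (k ≟ i) k≢i | dec-false (k ≟ j) k≢j = refl

  transpose-involutive : ∀ k → transpose i j (transpose i j k) ≡ k
  transpose-involutive k = by-cases (k ≟ i) (k ≟ j)
    where
    by-cases : Dec (k ≡ i) → Dec (k ≡ j) → transpose i j (transpose i j k) ≡ k
    by-cases (yes k≡i) _ = subst (λ k → transpose i j (transpose i j k) ≡ k) (sym k≡i)
      (trans (cong (transpose i j) transpose-matchˡ) transpose-matchʳ)
    by-cases (no _) (yes k≡j) = subst (λ k → transpose i j (transpose i j k) ≡ k) (sym k≡j)
      (trans (cong (transpose i j) transpose-matchʳ) transpose-matchˡ)
    by-cases (no k≢i) (no k≢j) =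
      trans (cong (transpose i j) (transpose-other k≢i k≢j)) (transpose-other k≢i k≢j)

T-injective : ∀ {b c} → T b ⇔ T c → b ≡ c
T-injective {false} {false} _   = refl
T-injective {false} {true}  b⇔c = contradiction (Equivalence.from b⇔c _) λ ()
T-injective {true}  {false} b⇔c = contradiction (Equivalence.to b⇔c _) λ ()
T-injective {true}  {true}  _   = refl

T-∧-⌊⌋ : ∀ b {P : Set} (p? : Dec P) → T (b ∧ ⌊ p? ⌋) ⇔ (T b × P)
T-∧-⌊⌋ false p?      = mk⇔ (λ ()) (λ ())
T-∧-⌊⌋ true  (yes p) = mk⇔ (λ _ → _ , p) (λ _ → _)
T-∧-⌊⌋ true  (no ¬p) = mk⇔ (λ ()) (λ (_ , p) → ¬p p)

one-above⇔one-below : ∀ {x y c} → x + y ≡ c + c → x ≡ c + 1 ⇔ y + 1 ≡ c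
one-above⇔one-below {x} {y} {c} x+y≡c+c = mk⇔
  (λ x≡c+1 → ℕ.+-cancelˡ-≡ c _ _ (trans (x∙yz≈xz∙y c y 1) (trans (cong (_+ y) (sym x≡c+1)) x+y≡c+c)))
  (λ y+1≡c → ℕ.+-cancelʳ-≡ c _ _ (begin
    x + c        ≡⟨ cong (x +_) y+1≡c ⟨
    x + (y + 1)  ≡⟨ ℕ.+-assoc x y 1 ⟨
    x + y + 1    ≡⟨ cong (_+ 1) x+y≡c+c ⟩
    c + c + 1    ≡⟨ xy∙z≈xz∙y c c 1 ⟩
    c + 1 + c    ∎))
  where open ≡-Reasoning

module _ (m : ℕ) .{{_ : NonZero m}} where

  IsStep : (Fin m → Fin m) → Set
  IsStep h = h ≡ inc m ⊎ h ≡ dec m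

  stepsTo : ∀ {N} (v x : Vertex m N) → Fin N → Bool
  stepsTo v x k = ⌊ _≟ᵛ_ m x (plusE m v k) ⌋ ∨ ⌊ _≟ᵛ_ m x (minusE m v k) ⌋

  adjacent⇒step : ∀ {N} {v x : Vertex m N} → T (adjacent m v x) →
    ∃₂ λ a h → IsStep h × x ≡ updateAt v a h
  adjacent⇒step {N} {v} {x} v~x with satisfied (any⁻ (stepsTo v x) (allFin N) v~x)
  ... | a , x≡v±eₐ with Equivalence.to (T-∨ {⌊ _≟ᵛ_ m x (plusE m v a) ⌋}) x≡v±eₐ
  ...   | inj₁ x≡v+eₐ = a , inc m , inj₁ refl , toWitness x≡v+eₐ
  ...   | inj₂ x≡v-eₐ = a , dec m , inj₂ refl , toWitness x≡v-eₐ

  step⇒adjacent : ∀ {N} (v : Vertex m N) a {h} → IsStep h → T (adjacent m v (updateAt v a h))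
  step⇒adjacent v a (inj₁ refl) = any⁺ (stepsTo v (plusE m v a)) (lose (∈-allFin a)
    (Equivalence.from (T-∨ {⌊ _≟ᵛ_ m (plusE m v a) (plusE m v a) ⌋}) (inj₁ (fromWitness refl))))
  step⇒adjacent v a (inj₂ refl) = any⁺ (stepsTo v (minusE m v a)) (lose (∈-allFin a)
    (Equivalence.from (T-∨ {⌊ _≟ᵛ_ m (minusE m v a) (plusE m v a) ⌋}) (inj₂ (fromWitness refl))))

  dist-updateAt : ∀ {N} (v : Vertex m N) a h →
    dist m (updateAt v a h) + level m (lookup v a) ≡ dist m v + level m (h (lookup v a))
  dist-updateAt (x ∷ v) zero    h =
    xy∙z≈zy∙x (level m (h x)) (dist m v) (level m x)
  dist-updateAt (x ∷ v) (suc a) h =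
    trans (ℕ.+-assoc (level m x) _ _)
      (trans (cong (level m x +_) (dist-updateAt v a h)) (sym (ℕ.+-assoc (level m x) _ _)))

  same-dist-updateAt⇒same-levels : ∀ {N} (v : Vertex m N) a h → dist m v ≡ dist m (updateAt v a h) →
    ∀ c → levelAt m v c ≡ levelAt m (updateAt v a h) c
  same-dist-updateAt⇒same-levels v a h dv≡dx c with c ≟ a
  ... | yes refl = trans level-preserved (cong (level m) (sym (lookup∘updateAt c v)))
    where
    level-preserved : level m (lookup v c) ≡ level m (h (lookup v c))
    level-preserved = ℕ.+-cancelˡ-≡ (dist m v) _ _
      (trans (cong (_+ level m (lookup v c)) dv≡dx) (dist-updateAt v c h))
  ... | no c≢a = cong (level m) (sym (lookup∘updateAt′ c a c≢a v))

  Complementary : ∀ {N} (v w x y : Vertex m N) → Set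
  Complementary v w x y = ∀ c →
    (lookup x c ≡ lookup v c × lookup y c ≡ lookup w c) ⊎ (lookup x c ≡ lookup w c × lookup y c ≡ lookup v c)

  dist-complementary : ∀ {N} {v w x y : Vertex m N} → Complementary v w x y →
    dist m y + dist m x ≡ dist m v + dist m w
  dist-complementary {v = []} {[]} {[]} {[]} _ = refl
  dist-complementary {v = a ∷ v} {b ∷ w} {c ∷ x} {d ∷ y} comp =
    trans (+-interchange (level m d) (dist m y) (level m c) (dist m x))
      (trans (cong₂ _+_ (head-levels (comp zero)) (dist-complementary {v = v} {w} {x} {y} (comp ∘ suc)))
        (+-interchange (level m a) (level m b) (dist m v) (dist m w)))
    where
    head-levels : (c ≡ a × d ≡ b) ⊎ (c ≡ b × d ≡ a) → level m d + level m c ≡ level m a + level m b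
    head-levels (inj₁ (refl , refl)) = ℕ.+-comm (level m b) (level m a)
    head-levels (inj₂ (refl , refl)) = refl

  transposeᵛ : ∀ {N} → Vertex m N → Vertex m N → Vertex m N → Vertex m N
  transposeᵛ v w x = tabulate λ c → transpose (lookup v c) (lookup w c) (lookup x c)

  transposeᵛ-involutive : ∀ {N} (v w x : Vertex m N) → transposeᵛ v w (transposeᵛ v w x) ≡ x
  transposeᵛ-involutive v w x = trans
    (tabulate-cong λ c → trans (cong (transpose _ _) (lookup∘tabulate _ c)) (transpose-involutive _ _ _))
    (tabulate∘lookup x)

  transposeᵛ-complementary : ∀ {N} {v w x y : Vertex m N} → Complementary v w x y → transposeᵛ v w x ≡ y
  transposeᵛ-complementary {v = v} {w} {x} {y} comp = trans (tabulate-cong swap) (tabulate∘lookup y)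
    where
    swap : ∀ c → transpose (lookup v c) (lookup w c) (lookup x c) ≡ lookup y c
    swap c with comp c
    ... | inj₁ (x≡v , y≡w) =
      trans (cong (transpose _ _) x≡v) (trans (transpose-matchˡ (lookup v c) (lookup w c)) (sym y≡w))
    ... | inj₂ (x≡w , y≡v) =
      trans (cong (transpose _ _) x≡w) (trans (transpose-matchʳ (lookup v c) (lookup w c)) (sym y≡v))

  square-complementary : ∀ {N} (v : Vertex m N) {a b} f g → a ≢ b →
    Complementary v (updateAt (updateAt v a f) b g) (updateAt v a f) (updateAt v b g)
  square-complementary v {a} {b} f g a≢b c with c ≟ a
  ... | yes refl = inj₂ (sym (lookup∘updateAt′ c b a≢b (updateAt v c f)) , lookup∘updateAt′ c b a≢b v)
  ... | no c≢a = inj₁ (lookup∘updateAt′ c a c≢a v , sym (begin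
    lookup (updateAt (updateAt v a f) b g) c  ≡⟨ cong (λ u → lookup u c) (updateAt-commutes a b a≢b v) ⟨
    lookup (updateAt (updateAt v b g) a f) c  ≡⟨ lookup∘updateAt′ c a c≢a (updateAt v b g) ⟩
    lookup (updateAt v b g) c                 ∎))
    where open ≡-Reasoning

  module _ {N : ℕ} where

    transposeᵛ-commonNeighbour : ∀ (v w x : Vertex m N) → (∃ λ k → levelAt m v k ≢ levelAt m w k) →
      dist m v ≡ dist m w → T (adjacent m v x) → T (adjacent m x w) →
      let x′ = transposeᵛ v w x in
      T (adjacent m v x′) × T (adjacent m x′ w) × dist m x′ + dist m x ≡ dist m v + dist m w
    transposeᵛ-commonNeighbour v w x (k , vₖ≢wₖ) dv≡dw v~x x~w with adjacent⇒step {v = v} {x} v~x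
    ... | a , f , f-step , refl with adjacent⇒step {v = updateAt v a f} {w} x~w
    ... | b , g , g-step , refl with a ≟ b
    ... | yes refl = contradiction
            (trans (same-dist-updateAt⇒same-levels v a (g ∘ f) (trans dv≡dw (cong (dist m) (updateAt-updateAt a v))) k)
                   (cong (λ u → levelAt m u k) (sym (updateAt-updateAt a v))))
            vₖ≢wₖ
    ... | no a≢b = subst
      (λ y → T (adjacent m v y) × T (adjacent m y w) × dist m y + dist m x ≡ dist m v + dist m w)
      (sym (transposeᵛ-complementary {v = v} {w} {x} square))
      ( step⇒adjacent v b g-step
      , subst (T ∘ adjacent m (updateAt v b g)) (updateAt-commutes a b a≢b v) (step⇒adjacent (updateAt v b g) a f-step)
      , dist-complementary {v = v} {w} {x} {updateAt v b g} square)
      where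
      square : Complementary v w x (updateAt v b g)
      square = square-complementary v f g a≢b

    -- A₊ f v unfolds to ∑[ u ∈ allVertices m N ] (if isInner v u then f u else 0ℤ),
    -- and A₋ f v likewise with isOuter.
    isInner isOuter : Vertex m N → Vertex m N → Bool
    isInner v u = adjacent m v u ∧ ⌊ dist m u + 1 ℕ.≟ dist m v ⌋
    isOuter v u = adjacent m v u ∧ ⌊ dist m u ℕ.≟ dist m v + 1 ⌋

    Comm-indicator : ∀ v w → Comm m (indicator m w) v ≡
      ∑[ x ∈ allVertices m N ] 𝟙 (isOuter v x ∧ isInner x w)
        - ∑[ x ∈ allVertices m N ] 𝟙 (isInner v x ∧ isOuter x w)
    Comm-indicator v w = cong₂ _-_ (two-steps isOuter isInner) (two-steps isInner isOuter)
      where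
      two-steps : (R S : Vertex m N → Vertex m N → Bool) →
        ∑[ x ∈ allVertices m N ]
          (if R v x then (∑[ u ∈ allVertices m N ] (if S x u then indicator m w u else 0ℤ)) else 0ℤ)
        ≡ ∑[ x ∈ allVertices m N ] 𝟙 (R v x ∧ S x w)
      two-steps R S = ∑-cong (allVertices m N) λ x → trans
        (if-cong-then (R v x) (∑-if-indicator (_≟ᵛ_ m) (allVertices m N) (allVertices-enumerates m N) (S x) w))
        (sym (if-∧ (R v x)))

    module _ (v w : Vertex m N) where

      T-upDown : ∀ y → T (isOuter v y ∧ isInner y w) ⇔
        ((T (adjacent m v y) × dist m y ≡ dist m v + 1) × (T (adjacent m y w) × dist m w + 1 ≡ dist m y))
      T-upDown y = ⇔.trans T-∧ (T-∧-⌊⌋ (adjacent m v y) _ ×-⇔ T-∧-⌊⌋ (adjacent m y w) _)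

      T-downUp : ∀ x → T (isInner v x ∧ isOuter x w) ⇔
        ((T (adjacent m v x) × dist m x + 1 ≡ dist m v) × (T (adjacent m x w) × dist m w ≡ dist m x + 1))
      T-downUp x = ⇔.trans T-∧ (T-∧-⌊⌋ (adjacent m v x) _ ×-⇔ T-∧-⌊⌋ (adjacent m x w) _)

      upDown∘transposeᵛ≡downUp : (∃ λ k → levelAt m v k ≢ levelAt m w k) → ∀ x →
        let x′ = transposeᵛ v w x in (isOuter v x′ ∧ isInner x′ w) ≡ (isInner v x ∧ isOuter x w)
      upDown∘transposeᵛ≡downUp levels-differ x = T-injective (mk⇔ up-down⇒down-up down-up⇒up-down)
        where
        σ : Vertex m N → Vertex m N
        σ = transposeᵛ v w

        corner : ∀ y → dist m v ≡ dist m w → T (adjacent m v y) → T (adjacent m y w) →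
          T (adjacent m v (σ y)) × T (adjacent m (σ y) w) × dist m (σ y) + dist m y ≡ dist m v + dist m v
        corner y dv≡dw v~y y~w =
          let (v~σy , σy~w , sum) = transposeᵛ-commonNeighbour v w y levels-differ dv≡dw v~y y~w
          in v~σy , σy~w , trans sum (cong (dist m v +_) (sym dv≡dw))

        down-up⇒up-down : T (isInner v x ∧ isOuter x w) → T (isOuter v (σ x) ∧ isInner (σ x) w)
        down-up⇒up-down down-up =
          let ((v~x , dx+1≡dv) , (x~w , dw≡dx+1)) = Equivalence.to (T-downUp x) down-up
              dv≡dw = trans (sym dx+1≡dv) (sym dw≡dx+1)
              (v~σx , σx~w , sum) = corner x dv≡dw v~x x~w
              dσx≡dv+1 = Equivalence.from (one-above⇔one-below {dist m (σ x)} {dist m x} sum) dx+1≡dv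
          in Equivalence.from (T-upDown (σ x))
               ((v~σx , dσx≡dv+1) , (σx~w , trans (cong (_+ 1) (sym dv≡dw)) (sym dσx≡dv+1)))

        up-down⇒down-up : T (isOuter v (σ x) ∧ isInner (σ x) w) → T (isInner v x ∧ isOuter x w)
        up-down⇒down-up up-down =
          let ((v~σx , dσx≡dv+1) , (σx~w , dw+1≡dσx)) = Equivalence.to (T-upDown (σ x)) up-down
              dv≡dw = sym (ℕ.+-cancelʳ-≡ 1 _ _ (trans dw+1≡dσx dσx≡dv+1))
              (v~x , x~w , sum) = subst
                (λ y → T (adjacent m v y) × T (adjacent m y w) × dist m y + dist m (σ x) ≡ dist m v + dist m v)
                (transposeᵛ-involutive v w x) (corner (σ x) dv≡dw v~σx σx~w)
              dx+1≡dv = Equivalence.to (one-above⇔one-below {dist m (σ x)} {dist m x}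
                (trans (ℕ.+-comm (dist m (σ x)) (dist m x)) sum)) dσx≡dv+1
          in Equivalence.from (T-downUp x) ((v~x , dx+1≡dv) , (x~w , trans (sym dv≡dw) (sym dx+1≡dv)))

mainTheorem1 : (m N : ℕ) → 3 ≤ m → 1 ≤ N → {{_ : NonZero m}} →
    (v w : Vertex m N) →
    ∃ (λ (k : Fin N) → levelAt m v k ≢ levelAt m w k) →
    Comm m (indicator m w) v ≡ 0ℤ
mainTheorem1 m N _ _ v w levels-differ = begin
  Comm m (indicator m w) v
    ≡⟨ Comm-indicator m v w ⟩
  ∑ all (𝟙 ∘ upDown) - ∑ all (𝟙 ∘ downUp)
    ≡⟨ cong (_- ∑ all (𝟙 ∘ downUp)) reindex ⟨
  ∑ all (𝟙 ∘ upDown ∘ σ) - ∑ all (𝟙 ∘ downUp)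
    ≡⟨ cong (_- ∑ all (𝟙 ∘ downUp)) (∑-cong all (cong 𝟙 ∘ upDown∘transposeᵛ≡downUp m v w levels-differ)) ⟩
  ∑ all (𝟙 ∘ downUp) - ∑ all (𝟙 ∘ downUp)
    ≡⟨ ℤ.+-inverseʳ (∑ all (𝟙 ∘ downUp)) ⟩
  0ℤ
    ∎
  where
  open ≡-Reasoning
  all : List (Vertex m N)
  all = allVertices m N
  σ : Vertex m N → Vertex m N
  σ = transposeᵛ m v w
  upDown downUp : Vertex m N → Bool
  upDown x = isOuter m v x ∧ isInner m x w
  downUp x = isInner m v x ∧ isOuter m x w
  reindex : ∑ all (𝟙 ∘ upDown ∘ σ) ≡ ∑ all (𝟙 ∘ upDown)
  reindex = ∑-reindex (_≟ᵛ_ m) all (allVertices-enumerates m N) σ (transposeᵛ-involutive m v w) (𝟙 ∘ upDown)
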